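{- Let $G$ be a connected chordal graph, $K^\star$ a maximal clique of $G$, and consider the layer structure of $C(G)$ rooted by $K^\star$. For every $i\ge 1$, every unit in the $i$-th layer $\mathcal{L}_i$ is adjacent (in the layer structure) to exactly one unit of the layer $\mathcal{L}_{i-1}$.
   Context: Graphs are finite, simple, undirected; chordal means no induced cycle of length greater than three. A $u$-$v$ separator of $G$ is a set $X\subseteq V(G)$ with $u,v$ in different components of $G-X$; it is minimal if no proper subset is one. The clique graph $C(G)$ has as nodes the maximal cliques of $G$; distinct nodes $K,K'$ are adjacent iff $K\cap K'$ is a minimal $u$-$v$ separator of $G$ for all $u\in K\setminus K'$, $v\in K'\setminus K$; edge $KK'$ has label $K\cap K'$ and weight $|K\cap K'|$. Units are the connected components of $C(G)$ after deleting all edges of minimum weight. An edge of $C(G)$ crosses units $U,U'$ if its endpoints lie one in each. The layer structure of $C(G)$ rooted by $K^\star$ is the graph whose vertices are the units, with $U,U'$ adjacent iff some edge of $C(G)$ crosses them; the label of edge $UU'$ is $K\cap K'$ for any edge $KK'$ of $C(G)$ crossing $U,U'$. The root is the unit containing $K^\star$, and $\mathcal{L}_i$ is the set of units at distance exactly $i$ from the root in the layer structure. -}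

module Defs where

open import Data.Nat using (ℕ; zero; suc; _+_; _≤_; _<_; _%_)
open import Data.Fin using (Fin; toℕ)
open import Data.Fin.Subset using (Subset; _∈_; _∉_; _⊆_; _⊂_; _∩_; ∣_∣; ⊥)
open import Data.Product using (Σ; _×_; ∃; ∃-syntax)
open import Data.Sum using (_⊎_)
open import Function using (_⇔_)
open import Function.Definitions using (Injective)
open import Relation.Nullary using (¬_)
open import Relation.Binary using (Decidable)
open import Relation.Binary.PropositionalEquality using (_≡_; _≢_)
open import Relation.Binary.Construct.Closure.ReflexiveTransitive using (Star)

record Graph (n : ℕ) : Set₁ where
  field
    E     : Fin n → Fin n → Set
    sym   : ∀ {u v} → E u v → E v u
    irr   : ∀ {u} → ¬ E u u
    adj?  : Decidable E
open Graph public

module _ {n : ℕ} (G : Graph n) where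

  data PathAvoid (X : Subset n) : Fin n → Fin n → Set where
    here : ∀ {u} → u ∉ X → PathAvoid X u u
    step : ∀ {u w v} → u ∉ X → E G u w → PathAvoid X w v → PathAvoid X u v

  Connected : Set
  Connected = ∀ u v → PathAvoid ⊥ u v

  Separator : Subset n → Fin n → Fin n → Set
  Separator X u v = u ∉ X × v ∉ X × ¬ PathAvoid X u v

  MinimalSeparator : Subset n → Fin n → Fin n → Set
  MinimalSeparator X u v =
    Separator X u v × (∀ Y → Y ⊂ X → ¬ Separator Y u v)

  CycAdj : (m : ℕ) → Fin (4 + m) → Fin (4 + m) → Set
  CycAdj m i j = (toℕ j ≡ suc (toℕ i) % (4 + m)) ⊎ (toℕ i ≡ suc (toℕ j) % (4 + m))

  InducedCycle : (m : ℕ) → (Fin (4 + m) → Fin n) → Set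
  InducedCycle m c = Injective _≡_ _≡_ c × (∀ i j → E G (c i) (c j) ⇔ CycAdj m i j)

  Chordal : Set
  Chordal = ∀ m (c : Fin (4 + m) → Fin n) → ¬ InducedCycle m c

  IsClique : Subset n → Set
  IsClique K = ∀ u v → u ∈ K → v ∈ K → u ≢ v → E G u v

  MaxClique : Subset n → Set
  MaxClique K = IsClique K × (∀ K' → IsClique K' → K ⊆ K' → K' ⊆ K)

  -- edges of the clique graph C(G)
  CEdge : Subset n → Subset n → Set
  CEdge K K' = MaxClique K × MaxClique K' × K ≢ K' ×
    (∀ u v → u ∈ K → u ∉ K' → v ∈ K' → v ∉ K → MinimalSeparator (K ∩ K') u v)

  -- weight of an edge KK' is ∣ K ∩ K' ∣
  MinWeightEdge : Subset n → Subset n → Set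
  MinWeightEdge K K' = CEdge K K' × (∀ L L' → CEdge L L' → ∣ K ∩ K' ∣ ≤ ∣ L ∩ L' ∣)

  KeptEdge : Subset n → Subset n → Set
  KeptEdge K K' = CEdge K K' × ¬ MinWeightEdge K K'

  SameUnit : Subset n → Subset n → Set
  SameUnit = Star KeptEdge

  -- adjacency in the layer structure, units represented by any member clique:
  -- the units of K and K' are distinct and some edge of C(G) crosses them
  LayerAdj : Subset n → Subset n → Set
  LayerAdj K K' = ¬ SameUnit K K' ×
    (∃[ L ] ∃[ L' ] (SameUnit K L × SameUnit K' L' × CEdge L L'))

  data LayerWalk : Subset n → Subset n → ℕ → Set where
    stop : ∀ {K K'} → SameUnit K K' → LayerWalk K K' 0
    move : ∀ {K L K' ℓ} → LayerAdj K L → LayerWalk L K' ℓ → LayerWalk K K' (suc ℓ)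

  InLayer : Subset n → ℕ → Subset n → Set
  InLayer Kstar i K = LayerWalk Kstar K i × (∀ j → j < i → ¬ LayerWalk Kstar K j)

module Submission where

-- The existence part is the last step of a shortest walk from the root. For uniqueness,
-- let AB be an edge of C(G) between the unit of K and a unit L of 𝓛ᵢ. It was deleted, so
-- S = A ∩ B has minimum weight, while the label of every kept edge has a vertex outside S;
-- hence "meeting the same component of G − S outside S" is constant on units. Chordality
-- gives a converse: two maximal cliques containing S on the same side of S lie in one unit
-- (by downward induction on X ∩ Y, moving along an induced path in the common
-- neighbourhood of X ∩ Y). Looking at where shortest walks from the root change side shows
-- that neither the root nor another predecessor L' is on the side of A, so the clique B' of
-- L' facing K contains S and lies on the side of B, whence L and L' share a unit.

open import Defs hiding (sym)
open import Data.Bool.Properties using () renaming (_≟_ to _≟ᵇ_)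
open import Data.Empty using (⊥; ⊥-elim)
open import Data.Fin using (Fin; toℕ) renaming (zero to fzero; suc to fsuc; _≟_ to _≟ᶠ_)
open import Data.Fin.Properties using (any?; all?; ¬∀⟶∃¬; toℕ-injective; toℕ<n)
open import Data.Fin.Subset using (Subset; _∈_; _∉_; _⊆_; _⊂_; _⊃_; _∩_; _∪_; ⁅_⁆; ∣_∣)
open import Data.Fin.Subset.Induction using (⊃-wellFounded)
open import Data.Fin.Subset.Properties
  using (_∈?_; _⊆?_; x∈p∩q⁺; p∩q⊆p; p∩q⊆q; ∩-comm; x∈p∪q⁺; x∈p∪q⁻; p⊆p∪q; x∈⁅x⁆; x∈⁅y⁆⇒x≡y;
         ⊆-antisym; p⊂q⇒∣p∣<∣q∣; p⊆q⇒∣p∣≤∣q∣)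
open import Data.Nat using (ℕ; zero; suc; _+_; _∸_; _≤_; _<_; z≤n; s≤s; _≤?_; _<?_; _≟_)
open import Data.Nat.DivMod using (_%_; m<n⇒m%n≡m; n%n≡0)
open import Data.Nat.Properties
open import Data.Product using (_×_; _,_; proj₁; proj₂; ∃; ∃₂; ∃-syntax)
open import Data.Sum using (_⊎_; inj₁; inj₂; [_,_]′; map₂)
open import Data.Vec.Properties using (≡-dec)
open import Function using (_∘_; id; const; mk⇔)
open import Induction.WellFounded using (Acc; acc)
open import Relation.Binary using (tri<; tri≈; tri>)
open import Relation.Binary.Construct.Closure.ReflexiveTransitive using (ε; _◅_; _◅◅_)
open import Relation.Binary.PropositionalEquality using (_≡_; _≢_; refl; sym; trans; cong; subst)
open import Relation.Nullary using (¬_; Dec; yes; no)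
open import Relation.Nullary.Decidable using (_×-dec_; _→-dec_; ¬?; map′; decidable-stable)

module _ {n : ℕ} where

  ⊈⇒∃∈∉ : {p q : Subset n} → ¬ p ⊆ q → ∃ λ x → x ∈ p × x ∉ q
  ⊈⇒∃∈∉ {p} {q} p⊈q
    with ¬∀⟶∃¬ n (λ x → x ∈ p → x ∈ q) (λ x → x ∈? p →-dec x ∈? q) (λ p⊆q → p⊈q (p⊆q _))
  ... | x , x∈p↛x∈q =
    x , decidable-stable (x ∈? p) (λ x∉p → x∈p↛x∈q (⊥-elim ∘ x∉p)) , x∈p↛x∈q ∘ const

  p⊆q∧∣q∣≤∣p∣⇒q⊆p : {p q : Subset n} → p ⊆ q → ∣ q ∣ ≤ ∣ p ∣ → q ⊆ p
  p⊆q∧∣q∣≤∣p∣⇒q⊆p {p} {q} p⊆q ∣q∣≤∣p∣ with q ⊆? p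
  ... | yes q⊆p = q⊆p
  ... | no q⊈p = ⊥-elim (<⇒≱ (p⊂q⇒∣p∣<∣q∣ (p⊆q , ⊈⇒∃∈∉ q⊈p)) ∣q∣≤∣p∣)

  x∉p⇒p⊂p∪⁅x⁆ : {p : Subset n} {x : Fin n} → x ∉ p → p ⊂ p ∪ ⁅ x ⁆
  x∉p⇒p⊂p∪⁅x⁆ {x = x} x∉p = p⊆p∪q ⁅ x ⁆ , x , x∈p∪q⁺ (inj₂ (x∈⁅x⁆ x)) , x∉p

  x∈p∪⁅y⁆⁻ : {p : Subset n} {x y : Fin n} → x ∈ p ∪ ⁅ y ⁆ → x ∈ p ⊎ x ≡ y
  x∈p∪⁅y⁆⁻ {p} {y = y} x∈ = map₂ (x∈⁅y⁆⇒x≡y y) (x∈p∪q⁻ p ⁅ y ⁆ x∈)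

  x∉p∪⁅y⁆ : {p : Subset n} {x y : Fin n} → x ∉ p → x ≢ y → x ∉ p ∪ ⁅ y ⁆
  x∉p∪⁅y⁆ x∉p x≢y x∈ = [ x∉p , x≢y ]′ (x∈p∪⁅y⁆⁻ x∈)

  x∈p∩q⇒x∈p : {p q : Subset n} {x : Fin n} → x ∈ p ∩ q → x ∈ p
  x∈p∩q⇒x∈p {p} {q} = p∩q⊆p p q

  x∈p∩q⇒x∈q : {p q : Subset n} {x : Fin n} → x ∈ p ∩ q → x ∈ q
  x∈p∩q⇒x∈q {p} {q} = p∩q⊆q p q

  _≟ˢ_ : (p q : Subset n) → Dec (p ≡ q)
  _≟ˢ_ = ≡-dec _≟ᵇ_

least-witness : (P : ℕ → Set) → (∀ k → Dec (P k)) → ∀ k → P k →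
                ∃ λ k₀ → k₀ ≤ k × P k₀ × (∀ j → j < k₀ → ¬ P j)
least-witness P P? zero P0 = 0 , z≤n , P0 , λ _ ()
least-witness P P? (suc k) Pk with P? 0
... | yes P0 = 0 , z≤n , P0 , λ _ ()
... | no ¬P0 with least-witness (P ∘ suc) (P? ∘ suc) k Pk
...   | k₀ , k₀≤k , Pk₀ , below =
  suc k₀ , s≤s k₀≤k , Pk₀ , λ { zero _ → ¬P0 ; (suc j) (s≤s j<k₀) → below j j<k₀ }

i+[k∸j]<k : ∀ {i j k} → i < j → j ≤ k → i + (k ∸ j) < k
i+[k∸j]<k {i} {j} {k} i<j j≤k = subst (i + (k ∸ j) <_) (m+[n∸m]≡n j≤k) (+-monoˡ-< (k ∸ j) i<j)

module _ {n : ℕ} (G : Graph n) where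

  infix 4 _~_ _~⁼_

  _~_ : Fin n → Fin n → Set
  _~_ = E G

  _~⁼_ : Fin n → Fin n → Set
  u ~⁼ v = u ≡ v ⊎ u ~ v

  ~-sym : ∀ {u v} → u ~ v → v ~ u
  ~-sym = Graph.sym G

  IsClique⇒~⁼ : ∀ {X} → IsClique G X → ∀ {u v} → u ∈ X → v ∈ X → u ~⁼ v
  IsClique⇒~⁼ X-clique {u} {v} u∈X v∈X with u ≟ᶠ v
  ... | yes u≡v = inj₁ u≡v
  ... | no u≢v = inj₂ (X-clique u v u∈X v∈X u≢v)

  path-start∉ : ∀ {Z u v} → PathAvoid G Z u v → u ∉ Z
  path-start∉ (here u∉Z) = u∉Z
  path-start∉ (step u∉Z _ _) = u∉Z

  path-end∉ : ∀ {Z u v} → PathAvoid G Z u v → v ∉ Z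
  path-end∉ (here v∉Z) = v∉Z
  path-end∉ (step _ _ π) = path-end∉ π

  path-weaken : ∀ {Z Z' u v} → Z' ⊆ Z → PathAvoid G Z u v → PathAvoid G Z' u v
  path-weaken Z'⊆Z (here u∉Z) = here (u∉Z ∘ Z'⊆Z)
  path-weaken Z'⊆Z (step u∉Z u~w π) = step (u∉Z ∘ Z'⊆Z) u~w (path-weaken Z'⊆Z π)

  path-++ : ∀ {Z u v w} → PathAvoid G Z u v → PathAvoid G Z v w → PathAvoid G Z u w
  path-++ (here _) σ = σ
  path-++ (step u∉Z u~w π) σ = step u∉Z u~w (path-++ π σ)

  path-cons⁼ : ∀ {Z u w v} → u ~⁼ w → u ∉ Z → PathAvoid G Z w v → PathAvoid G Z u v
  path-cons⁼ (inj₁ refl) _ π = π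
  path-cons⁼ (inj₂ u~w) u∉Z π = step u∉Z u~w π

  path-snoc⁼ : ∀ {Z u v w} → PathAvoid G Z u v → v ~⁼ w → w ∉ Z → PathAvoid G Z u w
  path-snoc⁼ π v~⁼w w∉Z = path-++ π (path-cons⁼ v~⁼w (path-end∉ π) (here w∉Z))

  path-reverse : ∀ {Z u v} → PathAvoid G Z u v → PathAvoid G Z v u
  path-reverse (here u∉Z) = here u∉Z
  path-reverse (step u∉Z u~w π) = path-snoc⁼ (path-reverse π) (inj₂ (~-sym u~w)) u∉Z

  path-after-last-visit : ∀ {Z a v} u → u ≢ v → PathAvoid G Z a v →
    PathAvoid G (Z ∪ ⁅ u ⁆) a v ⊎ ∃ λ w → u ~ w × w ∉ Z × PathAvoid G (Z ∪ ⁅ u ⁆) w v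
  path-after-last-visit u u≢v (here v∉Z) = inj₁ (here (x∉p∪⁅y⁆ v∉Z (u≢v ∘ sym)))
  path-after-last-visit {a = a} u u≢v (step a∉Z a~w π) with path-after-last-visit u u≢v π
  ... | inj₂ later = inj₂ later
  ... | inj₁ π' with a ≟ᶠ u
  ...   | yes refl = inj₂ (_ , a~w , path-start∉ π , π')
  ...   | no a≢u = inj₁ (step (x∉p∪⁅y⁆ a∉Z a≢u) a~w π')

  path? : ∀ Z u v → Dec (PathAvoid G Z u v)
  path? Z = path?-acc (⊃-wellFounded Z)
    where
    path?-acc : ∀ {Z} → Acc _⊃_ Z → ∀ u v → Dec (PathAvoid G Z u v)
    path?-acc {Z} (acc larger) u v with u ∈? Z | v ∈? Z | u ≟ᶠ v
    ... | yes u∈Z | _ | _ = no (λ π → path-start∉ π u∈Z)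
    ... | no _ | yes v∈Z | _ = no (λ π → path-end∉ π v∈Z)
    ... | no u∉Z | no _ | yes refl = yes (here u∉Z)
    ... | no u∉Z | no _ | no u≢v =
      map′ (λ { (w , u~w , w∉Z , π) → step u∉Z u~w (path-weaken (p⊆p∪q ⁅ u ⁆) π) })
           (λ π → [ (λ π' → ⊥-elim (path-start∉ π' (x∈p∪q⁺ (inj₂ (x∈⁅x⁆ u))))) , id ]′
                    (path-after-last-visit u u≢v π))
           (any? λ w → adj? G u w ×-dec ¬? (w ∈? Z) ×-dec path?-acc (larger (x∉p⇒p⊂p∪⁅x⁆ u∉Z)) w v)

  data LPath (Z : Subset n) : ℕ → Fin n → Fin n → Set where
    here : ∀ {u} → u ∉ Z → LPath Z 0 u u
    step : ∀ {u w v k} → u ∉ Z → u ~ w → LPath Z k w v → LPath Z (suc k) u v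

  PathAvoid⇒LPath : ∀ {Z u v} → PathAvoid G Z u v → ∃ λ k → LPath Z k u v
  PathAvoid⇒LPath (here u∉Z) = 0 , here u∉Z
  PathAvoid⇒LPath (step u∉Z u~w π) = let k , π' = PathAvoid⇒LPath π in suc k , step u∉Z u~w π'

  LPath? : ∀ Z k u v → Dec (LPath Z k u v)
  LPath? Z zero u v with u ∈? Z | u ≟ᶠ v
  ... | yes u∈Z | _ = no λ { (here u∉Z) → u∉Z u∈Z }
  ... | no u∉Z | yes refl = yes (here u∉Z)
  ... | no _ | no u≢v = no λ { (here _) → u≢v refl }
  LPath? Z (suc k) u v with u ∈? Z
  ... | yes u∈Z = no λ { (step u∉Z _ _) → u∉Z u∈Z }
  ... | no u∉Z = map′ (λ { (w , u~w , π) → step u∉Z u~w π }) (λ { (step _ u~w π) → _ , u~w , π })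
                      (any? λ w → adj? G u w ×-dec LPath? Z k w v)

  -- the l-th vertex, constant after the end of the path
  vertex : ∀ {Z k u v} → LPath Z k u v → ℕ → Fin n
  vertex (here {u} _) _ = u
  vertex (step {u} _ _ _) zero = u
  vertex (step _ _ π) (suc l) = vertex π l

  vertex-start : ∀ {Z k u v} (π : LPath Z k u v) → vertex π 0 ≡ u
  vertex-start (here _) = refl
  vertex-start (step _ _ _) = refl

  vertex-end : ∀ {Z k u v} (π : LPath Z k u v) → vertex π k ≡ v
  vertex-end (here _) = refl
  vertex-end (step _ _ π) = vertex-end π

  vertex-~ : ∀ {Z k u v} (π : LPath Z k u v) → ∀ l → l < k → vertex π l ~ vertex π (suc l)
  vertex-~ (step _ u~w π) zero _ = subst (_ ~_) (sym (vertex-start π)) u~w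
  vertex-~ (step _ _ π) (suc l) (s≤s l<k) = vertex-~ π l l<k

  vertex-∉ : ∀ {Z k u v} (π : LPath Z k u v) → ∀ l → vertex π l ∉ Z
  vertex-∉ (here u∉Z) _ = u∉Z
  vertex-∉ (step u∉Z _ _) zero = u∉Z
  vertex-∉ (step _ _ π) (suc l) = vertex-∉ π l

  take : ∀ {Z k u v} (π : LPath Z k u v) → ∀ i → i ≤ k → LPath Z i u (vertex π i)
  take (here u∉Z) zero _ = here u∉Z
  take (step u∉Z _ _) zero _ = here u∉Z
  take (step u∉Z u~w π) (suc i) (s≤s i≤k) = step u∉Z u~w (take π i i≤k)

  drop : ∀ {Z k u v} (π : LPath Z k u v) → ∀ i → i ≤ k → LPath Z (k ∸ i) (vertex π i) v
  drop (here u∉Z) zero _ = here u∉Z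
  drop (step u∉Z u~w π) zero _ = step u∉Z u~w π
  drop (step _ _ π) (suc i) (s≤s i≤k) = drop π i i≤k

  LPath-++ : ∀ {Z a b u w v} → LPath Z a u w → LPath Z b w v → LPath Z (a + b) u v
  LPath-++ (here _) σ = σ
  LPath-++ (step u∉Z u~w π) σ = step u∉Z u~w (LPath-++ π σ)

  record InducedPath (g : ℕ → Fin n) (k : ℕ) : Set where
    field
      adjacent  : ∀ r → r < k → g r ~ g (suc r)
      chordless : ∀ r s → suc r < s → s ≤ k → ¬ g r ~ g s
      distinct  : ∀ r s → r < s → s ≤ k → g r ≢ g s

  -- a chord or a repeated vertex would give a shortcut
  shortest⇒induced : ∀ {Z k u v} (π : LPath Z k u v) → (∀ j → j < k → ¬ LPath Z j u v) →
    InducedPath (vertex π) k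
  shortest⇒induced {Z} {k} {u} {v} π shortest = record
    { adjacent = vertex-~ π ; chordless = chordless ; distinct = distinct }
    where
    chordless : ∀ r s → suc r < s → s ≤ k → ¬ vertex π r ~ vertex π s
    chordless r s r+1<s s≤k chord = shortest _
      (subst (_< k) (sym (+-suc r (k ∸ s))) (i+[k∸j]<k r+1<s s≤k))
      (LPath-++ (take π r (≤-trans (≤-trans (n≤1+n r) (<⇒≤ r+1<s)) s≤k))
                (step (vertex-∉ π r) chord (drop π s s≤k)))
    distinct : ∀ r s → r < s → s ≤ k → vertex π r ≢ vertex π s
    distinct r s r<s s≤k same = shortest _ (i+[k∸j]<k r<s s≤k)
      (LPath-++ (take π r (≤-trans (<⇒≤ r<s) s≤k))
                (subst (λ z → LPath Z (k ∸ s) z v) (sym same) (drop π s s≤k)))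

  InducedPath-segment : ∀ {g k} a {ℓ} → InducedPath g k → a + ℓ ≤ k → InducedPath (λ r → g (a + r)) ℓ
  InducedPath-segment {g} {k} a {ℓ} P a+ℓ≤k = record
    { adjacent = λ r r<ℓ → subst (λ z → g (a + r) ~ g z) (sym (+-suc a r))
                                 (adjacent (a + r) (<-≤-trans (+-monoʳ-< a r<ℓ) a+ℓ≤k))
    ; chordless = λ r s r+1<s s≤ℓ → chordless (a + r) (a + s)
                    (subst (_< a + s) (+-suc a r) (+-monoʳ-< a r+1<s)) (inside s≤ℓ)
    ; distinct = λ r s r<s s≤ℓ → distinct (a + r) (a + s) (+-monoʳ-< a r<s) (inside s≤ℓ)
    }
    where
    open InducedPath P
    inside : ∀ {s} → s ≤ ℓ → a + s ≤ k
    inside s≤ℓ = ≤-trans (+-monoʳ-≤ a s≤ℓ) a+ℓ≤k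

  -- x, the induced path g 0 … g (2 + m) and back to x form an induced cycle of length 4 + m
  chordal⇒no-hole : Chordal G → ∀ {g m x} → InducedPath g (2 + m) → (∀ r → r ≤ 2 + m → g r ≢ x) →
    x ~ g 0 → x ~ g (2 + m) → (∀ r → 0 < r → r < 2 + m → ¬ x ~ g r) → ⊥
  chordal⇒no-hole chordal {g} {m} {x} P g≢x x~start x~end x≁inner =
    chordal m c (c-injective , λ i j → mk⇔ (~⇒CycAdj i j) (CycAdj⇒~ i j))
    where
    open InducedPath P

    N : ℕ
    N = 4 + m

    c : Fin N → Fin n
    c fzero = x
    c (fsuc r) = g (toℕ r)

    bound : (r : Fin (3 + m)) → toℕ r ≤ 2 + m
    bound r = ≤-pred (toℕ<n r)

    c-injective : ∀ {i j} → c i ≡ c j → i ≡ j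
    c-injective {fzero} {fzero} _ = refl
    c-injective {fzero} {fsuc s} x≡gs = ⊥-elim (g≢x (toℕ s) (bound s) (sym x≡gs))
    c-injective {fsuc r} {fzero} gr≡x = ⊥-elim (g≢x (toℕ r) (bound r) gr≡x)
    c-injective {fsuc r} {fsuc s} gr≡gs with <-cmp (toℕ r) (toℕ s)
    ... | tri< r<s _ _ = ⊥-elim (distinct _ _ r<s (bound s) gr≡gs)
    ... | tri≈ _ r≡s _ = cong fsuc (toℕ-injective r≡s)
    ... | tri> _ _ s<r = ⊥-elim (distinct _ _ s<r (bound r) (sym gr≡gs))

    next⇒~ : ∀ i j → toℕ j ≡ suc (toℕ i) % N → c i ~ c j
    next⇒~ fzero fzero ()
    next⇒~ fzero (fsuc s) s+1≡1 = subst (λ t → x ~ g t) (sym (suc-injective s+1≡1)) x~start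
    next⇒~ (fsuc r) j j≡ with toℕ r ≟ 2 + m
    next⇒~ (fsuc r) fzero _ | yes r≡last = ~-sym (subst (λ t → x ~ g t) (sym r≡last) x~end)
    next⇒~ (fsuc r) (fsuc s) j≡ | yes r≡last
      with trans j≡ (trans (cong (λ t → suc (suc t) % N) r≡last) (n%n≡0 N))
    ... | ()
    next⇒~ (fsuc r) j j≡ | no r≢last
      with trans j≡ (m<n⇒m%n≡m (s≤s (s≤s (≤∧≢⇒< (bound r) r≢last))))
    next⇒~ (fsuc r) fzero _ | no _ | ()
    next⇒~ (fsuc r) (fsuc s) _ | no r≢last | s+1≡r+2 =
      subst (λ t → g (toℕ r) ~ g t) (sym (suc-injective s+1≡r+2))
            (adjacent (toℕ r) (≤∧≢⇒< (bound r) r≢last))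

    CycAdj⇒~ : ∀ i j → CycAdj G m i j → c i ~ c j
    CycAdj⇒~ i j (inj₁ j≡next) = next⇒~ i j j≡next
    CycAdj⇒~ i j (inj₂ i≡next) = ~-sym (next⇒~ j i i≡next)

    consecutive : ∀ r s → toℕ r < toℕ s → g (toℕ r) ~ g (toℕ s) → toℕ (fsuc s) ≡ suc (toℕ (fsuc r)) % N
    consecutive r s r<s gr~gs with suc (toℕ r) ≟ toℕ s
    ... | yes r+1≡s =
      sym (trans (m<n⇒m%n≡m (s≤s (subst (_< 3 + m) (sym r+1≡s) (toℕ<n s)))) (cong suc r+1≡s))
    ... | no r+1≢s = ⊥-elim (chordless _ _ (≤∧≢⇒< r<s r+1≢s) (bound s) gr~gs)

    ~⇒CycAdj : ∀ i j → c i ~ c j → CycAdj G m i j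
    ~⇒CycAdj fzero fzero x~x = ⊥-elim (Graph.irr G x~x)
    ~⇒CycAdj fzero (fsuc s) x~gs with toℕ s ≟ 0 | toℕ s ≟ 2 + m
    ... | yes s≡0 | _ = inj₁ (cong suc s≡0)
    ... | no _ | yes s≡last = inj₂ (sym (trans (cong (λ t → suc (suc t) % N) s≡last) (n%n≡0 N)))
    ... | no s≢0 | no s≢last =
      ⊥-elim (x≁inner (toℕ s) (n≢0⇒n>0 s≢0) (≤∧≢⇒< (bound s) s≢last) x~gs)
    ~⇒CycAdj (fsuc r) fzero gr~x = Data.Sum.swap (~⇒CycAdj fzero (fsuc r) (~-sym gr~x))
    ~⇒CycAdj (fsuc r) (fsuc s) gr~gs with <-cmp (toℕ r) (toℕ s)
    ... | tri< r<s _ _ = inj₁ (consecutive r s r<s gr~gs)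
    ... | tri≈ _ r≡s _ = ⊥-elim (Graph.irr G (subst (λ t → g (toℕ r) ~ g t) (sym r≡s) gr~gs))
    ... | tri> _ _ s<r = inj₂ (consecutive s r s<r (~-sym gr~gs))

  ~ends⇒~all : Chordal G → ∀ {g k x} → InducedPath g k → (∀ r → r ≤ k → g r ≢ x) →
    x ~ g 0 → x ~ g k → ∀ l → l ≤ k → x ~ g l
  ~ends⇒~all chordal {g} {k} {x} P g≢x x~start x~end = go
    where
    -- between a neighbour g a and the next neighbour g (a + 2 + m) of x there would be a hole
    no-gap : ∀ a → suc a ≤ k → x ~ g a → ¬ x ~ g (suc a) → ⊥
    no-gap a a<k x~gₐ x≁gₐ₊₁
      with least-witness (λ t → x ~ g (suc a + t)) (λ t → adj? G x (g (suc a + t))) (k ∸ suc a)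
                         (subst (λ t → x ~ g t) (sym (m+[n∸m]≡n a<k)) x~end)
    ... | zero , _ , x~gₐ₊₁ , _ = x≁gₐ₊₁ (subst (λ t → x ~ g t) (+-identityʳ (suc a)) x~gₐ₊₁)
    ... | suc m , m<k∸a , x~gₐ₊₂₊ₘ , x≁before =
      chordal⇒no-hole chordal (InducedPath-segment a P segment≤k)
        (λ r r≤ → g≢x (a + r) (≤-trans (+-monoʳ-≤ a r≤) segment≤k))
        (subst (λ t → x ~ g t) (sym (+-identityʳ a)) x~gₐ)
        (subst (λ t → x ~ g t) (sym (+-suc a (suc m))) x~gₐ₊₂₊ₘ)
        inner
      where
      segment≤k : a + (2 + m) ≤ k
      segment≤k = subst (_≤ k) (sym (+-suc a (suc m)))
        (subst (suc a + suc m ≤_) (m+[n∸m]≡n a<k) (+-monoʳ-≤ (suc a) m<k∸a))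
      inner : ∀ r → 0 < r → r < 2 + m → ¬ x ~ g (a + r)
      inner (suc r) _ (s≤s r<m+1) = x≁before r r<m+1 ∘ subst (λ t → x ~ g t) (+-suc a r)

    go : ∀ l → l ≤ k → x ~ g l
    go zero _ = x~start
    go (suc l) l<k with adj? G x (g (suc l))
    ... | yes x~gₗ₊₁ = x~gₗ₊₁
    ... | no x≁gₗ₊₁ = ⊥-elim (no-gap l l<k (go l (<⇒≤ l<k)) x≁gₗ₊₁)

  record CommonNeighbourPath (I : Subset n) (m : ℕ) (g : ℕ → Fin n) : Set where
    field
      adjacent  : ∀ l → l < m → g l ~ g (suc l)
      avoids    : ∀ l → l ≤ m → g l ∉ I
      dominated : ∀ l → l ≤ m → ∀ x → x ∈ I → x ~ g l

  CommonNeighbourPath-tail : ∀ {I m g} → CommonNeighbourPath I (suc m) g → CommonNeighbourPath I m (g ∘ suc)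
  CommonNeighbourPath-tail P = record
    { adjacent = λ l l<m → adjacent (suc l) (s≤s l<m)
    ; avoids = λ l l≤m → avoids (suc l) (s≤s l≤m)
    ; dominated = λ l l≤m → dominated (suc l) (s≤s l≤m)
    }
    where open CommonNeighbourPath P

  -- a shortest p–q path in G − I is induced, so it stays in the common neighbourhood of I
  chordal⇒common-neighbour-path : Chordal G → ∀ {I p q} → PathAvoid G I p q →
    (∀ x → x ∈ I → x ~ p) → (∀ x → x ∈ I → x ~ q) →
    ∃₂ λ m (g : ℕ → Fin n) → g 0 ≡ p × g m ≡ q × CommonNeighbourPath I m g
  chordal⇒common-neighbour-path chordal {I} {p} {q} π I~p I~q with PathAvoid⇒LPath π
  ... | k , π' with least-witness (λ j → LPath I j p q) (λ j → LPath? I j p q) k π'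
  ...   | m , _ , σ , shortest = m , vertex σ , vertex-start σ , vertex-end σ , record
    { adjacent = vertex-~ σ
    ; avoids = λ l _ → vertex-∉ σ l
    ; dominated = λ l l≤m x x∈I → ~ends⇒~all chordal (shortest⇒induced σ shortest)
        (λ r _ σᵣ≡x → vertex-∉ σ r (subst (_∈ I) (sym σᵣ≡x) x∈I))
        (subst (x ~_) (sym (vertex-start σ)) (I~p x x∈I))
        (subst (x ~_) (sym (vertex-end σ)) (I~q x x∈I)) l l≤m
    }

  IsClique-∪⁅⁆ : ∀ {C v} → IsClique G C → (∀ c → c ∈ C → c ≢ v → c ~ v) → IsClique G (C ∪ ⁅ v ⁆)
  IsClique-∪⁅⁆ C-clique C~v a b a∈ b∈ a≢b with x∈p∪⁅y⁆⁻ a∈ | x∈p∪⁅y⁆⁻ b∈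
  ... | inj₁ a∈C | inj₁ b∈C = C-clique a b a∈C b∈C a≢b
  ... | inj₁ a∈C | inj₂ refl = C~v a a∈C a≢b
  ... | inj₂ refl | inj₁ b∈C = ~-sym (C~v b b∈C (a≢b ∘ sym))
  ... | inj₂ refl | inj₂ refl = ⊥-elim (a≢b refl)

  IsClique⇒⊆MaxClique : ∀ {C} → IsClique G C → ∃ λ M → MaxClique G M × C ⊆ M
  IsClique⇒⊆MaxClique {C} = go (⊃-wellFounded C)
    where
    go : ∀ {C} → Acc _⊃_ C → IsClique G C → ∃ λ M → MaxClique G M × C ⊆ M
    go {C} (acc larger) C-clique with any? (λ v → ¬? (v ∈? C) ×-dec all? (λ c → c ∈? C →-dec adj? G c v))
    ... | yes (v , v∉C , C~v)
      with go (larger (x∉p⇒p⊂p∪⁅x⁆ v∉C)) (IsClique-∪⁅⁆ C-clique (λ c c∈C _ → C~v c c∈C))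
    ...   | M , M-max , C∪v⊆M = M , M-max , λ c∈C → C∪v⊆M (p⊆p∪q ⁅ v ⁆ c∈C)
    go {C} _ C-clique | no unextendable = C , (C-clique , maximal) , id
      where
      maximal : ∀ K → IsClique G K → C ⊆ K → K ⊆ C
      maximal K K-clique C⊆K {w} w∈K = decidable-stable (w ∈? C) λ w∉C → unextendable
        (w , w∉C , λ c c∈C → K-clique c w (C⊆K c∈C) w∈K (λ c≡w → w∉C (subst (_∈ C) c≡w c∈C)))

  MaxClique-≢⇒∃∈∉ : ∀ {K K'} → MaxClique G K → MaxClique G K' → K ≢ K' → ∃ λ p → p ∈ K × p ∉ K'
  MaxClique-≢⇒∃∈∉ {K} {K'} (_ , K-max) (K'-clique , _) K≢K' with K ⊆? K'
  ... | yes K⊆K' = ⊥-elim (K≢K' (⊆-antisym K⊆K' (K-max K' K'-clique K⊆K')))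
  ... | no K⊈K' = ⊈⇒∃∈∉ K⊈K'

  -- minimality is automatic: u – s – v avoids every Y ⊂ K ∩ K' missing s
  separating⇒CEdge : ∀ {K K'} → MaxClique G K → MaxClique G K' → K ≢ K' →
    (∀ u v → u ∈ K → u ∉ K' → v ∈ K' → v ∉ K → ¬ PathAvoid G (K ∩ K') u v) → CEdge G K K'
  separating⇒CEdge {K} {K'} K-max@(K-clique , _) K'-max@(K'-clique , _) K≢K' separates =
    K-max , K'-max , K≢K' , λ u v u∈K u∉K' v∈K' v∉K →
      (u∉K' ∘ x∈p∩q⇒x∈q , v∉K ∘ x∈p∩q⇒x∈p , separates u v u∈K u∉K' v∈K' v∉K) ,
      λ { Y (_ , s , s∈K∩K' , s∉Y) (u∉Y , v∉Y , ¬path) → ¬path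
            (step u∉Y (K-clique u s u∈K (x∈p∩q⇒x∈p s∈K∩K')
                                  (λ u≡s → u∉K' (subst (_∈ K') (sym u≡s) (x∈p∩q⇒x∈q s∈K∩K'))))
            (step s∉Y (K'-clique s v (x∈p∩q⇒x∈q s∈K∩K') v∈K'
                                  (λ s≡v → v∉K (subst (_∈ K) s≡v (x∈p∩q⇒x∈p s∈K∩K'))))
            (here v∉Y))) }

  CEdge-maxˡ : ∀ {K K'} → CEdge G K K' → MaxClique G K
  CEdge-maxˡ = proj₁

  CEdge-maxʳ : ∀ {K K'} → CEdge G K K' → MaxClique G K'
  CEdge-maxʳ = proj₁ ∘ proj₂

  CEdge-sym : ∀ {K K'} → CEdge G K K' → CEdge G K' K
  CEdge-sym {K} {K'} (K-max , K'-max , K≢K' , separates) =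
    K'-max , K-max , K≢K' ∘ sym , λ u v u∈K' u∉K v∈K v∉K' →
      subst (λ Z → MinimalSeparator G Z u v) (∩-comm K K') (reverse (separates v u v∈K v∉K' u∈K' u∉K))
    where
    reverse : ∀ {X u v} → MinimalSeparator G X v u → MinimalSeparator G X u v
    reverse ((v∉X , u∉X , ¬path) , minimal) =
      (u∉X , v∉X , ¬path ∘ path-reverse) ,
      λ Y Y⊂X (u∉Y , v∉Y , ¬path') → minimal Y Y⊂X (v∉Y , u∉Y , ¬path' ∘ path-reverse)

  KeptEdge-sym : ∀ {K K'} → KeptEdge G K K' → KeptEdge G K' K
  KeptEdge-sym {K} {K'} (KK' , ¬lightest) = CEdge-sym KK' , λ (K'K , lightest) →
    ¬lightest (KK' , λ L L' LL' → subst (_≤ ∣ L ∩ L' ∣) (cong ∣_∣ (∩-comm K' K)) (lightest L L' LL'))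

  SameUnit-sym : ∀ {K K'} → SameUnit G K K' → SameUnit G K' K
  SameUnit-sym ε = ε
  SameUnit-sym (kept ◅ rest) = SameUnit-sym rest ◅◅ (KeptEdge-sym kept ◅ ε)

  SameUnit⇒MaxClique : ∀ {K K'} → SameUnit G K K' → MaxClique G K' → MaxClique G K
  SameUnit⇒MaxClique ε K'-max = K'-max
  SameUnit⇒MaxClique ((KL , _) ◅ _) _ = CEdge-maxˡ KL

  LayerAdj-sym : ∀ {K K'} → LayerAdj G K K' → LayerAdj G K' K
  LayerAdj-sym (K≁K' , L , L' , K~L , K'~L' , LL') =
    K≁K' ∘ SameUnit-sym , L' , L , K'~L' , K~L , CEdge-sym LL'

  LayerAdj-respˡ : ∀ {K₀ K K'} → SameUnit G K₀ K → LayerAdj G K K' → LayerAdj G K₀ K'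
  LayerAdj-respˡ K₀~K (K≁K' , L , L' , K~L , K'~L' , LL') =
    (λ K₀~K' → K≁K' (SameUnit-sym K₀~K ◅◅ K₀~K')) , L , L' , K₀~K ◅◅ K~L , K'~L' , LL'

  LayerAdj-respʳ : ∀ {K K' K₁} → LayerAdj G K K' → SameUnit G K' K₁ → LayerAdj G K K₁
  LayerAdj-respʳ K⋯K' K'~K₁ = LayerAdj-sym (LayerAdj-respˡ (SameUnit-sym K'~K₁) (LayerAdj-sym K⋯K'))

  LayerAdj⇒MaxClique : ∀ {K K'} → LayerAdj G K K' → MaxClique G K
  LayerAdj⇒MaxClique (_ , _ , _ , K~L , _ , LL') = SameUnit⇒MaxClique K~L (CEdge-maxˡ LL')

  LayerWalk-respʳ : ∀ {K K' K₁ l} → LayerWalk G K K' l → SameUnit G K' K₁ → LayerWalk G K K₁ l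
  LayerWalk-respʳ (stop K~K') K'~K₁ = stop (K~K' ◅◅ K'~K₁)
  LayerWalk-respʳ (move K⋯L w) K'~K₁ = move K⋯L (LayerWalk-respʳ w K'~K₁)

  LayerWalk-snoc : ∀ {K M N l} → LayerWalk G K M l → LayerAdj G M N → LayerWalk G K N (suc l)
  LayerWalk-snoc (stop K~M) M⋯N = move (LayerAdj-respˡ K~M M⋯N) (stop ε)
  LayerWalk-snoc (move K⋯L w) M⋯N = move K⋯L (LayerWalk-snoc w M⋯N)

  LayerWalk-unsnoc : ∀ {K N l} → LayerWalk G K N (suc l) → ∃ λ M → LayerWalk G K M l × LayerAdj G M N
  LayerWalk-unsnoc {l = zero} (move K⋯L (stop L~N)) = _ , stop ε , LayerAdj-respʳ K⋯L L~N
  LayerWalk-unsnoc {l = suc l} (move K⋯L w) =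
    let M , w' , M⋯N = LayerWalk-unsnoc w in M , move K⋯L w' , M⋯N

  InLayer-suc⇒adjacent-to-previous : ∀ {Kstar i K} → InLayer G Kstar (suc i) K →
    ∃[ K' ] (MaxClique G K' × InLayer G Kstar i K' × LayerAdj G K K')
  InLayer-suc⇒adjacent-to-previous (w , shortest) with LayerWalk-unsnoc w
  ... | M , w' , M⋯K = M , LayerAdj⇒MaxClique M⋯K ,
    (w' , λ j j<i w'' → shortest (suc j) (s≤s j<i) (LayerWalk-snoc w'' M⋯K)) , LayerAdj-sym M⋯K

  record Crossing (M : Subset n) (l : ℕ) (P : Subset n → Set) : Set where
    field
      {X Y}   : Subset n
      j       : ℕ
      j<l     : j < l
      walk-X  : LayerWalk G M X j
      walk-Y  : LayerWalk G M Y (suc j)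
      edge    : CEdge G X Y
      P-X     : P X
      ¬P-Y    : ¬ P Y

  LayerWalk⇒Crossing : ∀ {P : Subset n → Set} → (∀ X → Dec (P X)) →
    (∀ {X Y} → SameUnit G X Y → P X → P Y) →
    ∀ {M L l} → LayerWalk G M L l → P M → ¬ P L → Crossing M l P
  LayerWalk⇒Crossing P? P-resp (stop M~L) PM ¬PL = ⊥-elim (¬PL (P-resp M~L PM))
  LayerWalk⇒Crossing P? P-resp (move {L = N} M⋯N@(_ , _ , _ , M~X , N~Y , XY) w) PM ¬PL with P? N
  ... | yes PN = record
    { j = suc j ; j<l = s≤s j<l ; walk-X = move M⋯N walk-X ; walk-Y = move M⋯N walk-Y
    ; edge = edge ; P-X = P-X ; ¬P-Y = ¬P-Y }
    where open Crossing (LayerWalk⇒Crossing P? P-resp w PN ¬PL)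
  ... | no ¬PN = record
    { j = 0 ; j<l = s≤s z≤n ; walk-X = stop M~X ; walk-Y = move M⋯N (stop N~Y)
    ; edge = XY ; P-X = P-resp M~X PM ; ¬P-Y = ¬PN ∘ P-resp (SameUnit-sym N~Y) }

  ¬SameUnit⇒lightest : ∀ {A B} → CEdge G A B → ¬ SameUnit G A B →
    ∀ X Y → CEdge G X Y → ∣ A ∩ B ∣ ≤ ∣ X ∩ Y ∣
  ¬SameUnit⇒lightest AB A≁B X Y XY = decidable-stable (_ ≤? _) λ AB≰XY →
    A≁B ((AB , λ (_ , lightest) → AB≰XY (lightest X Y XY)) ◅ ε)

  ¬SameUnit⇒kept-heavier : ∀ {A B} → CEdge G A B → ¬ SameUnit G A B →
    ∀ X Y → KeptEdge G X Y → ∣ A ∩ B ∣ < ∣ X ∩ Y ∣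
  ¬SameUnit⇒kept-heavier AB A≁B X Y (XY , XY-heavy) = decidable-stable (_ <? _) λ AB≮XY →
    A≁B ((AB , λ (_ , lightest) → XY-heavy (XY , λ L L' LL' → ≤-trans (≮⇒≥ AB≮XY) (lightest L L' LL'))) ◅ ε)

  module Separation (chordal : Chordal G) {A B : Subset n} (AB : CEdge G A B)
    (AB-lightest : ∀ X Y → CEdge G X Y → ∣ A ∩ B ∣ ≤ ∣ X ∩ Y ∣)
    (kept-heavier : ∀ X Y → KeptEdge G X Y → ∣ A ∩ B ∣ < ∣ X ∩ Y ∣) where

    S : Subset n
    S = A ∩ B

    A-max : MaxClique G A
    A-max = CEdge-maxˡ AB

    B-max : MaxClique G B
    B-max = CEdge-maxʳ AB

    A≢B : A ≢ B
    A≢B = proj₁ (proj₂ (proj₂ AB))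

    S-separates : ∀ u v → u ∈ A → u ∉ B → v ∈ B → v ∉ A → MinimalSeparator G S u v
    S-separates = proj₂ (proj₂ (proj₂ AB))

    SameSide : Subset n → Subset n → Set
    SameSide X Y = ∃₂ λ x y → x ∈ X × x ∉ S × y ∈ Y × y ∉ S × PathAvoid G S x y

    SameSide? : ∀ X Y → Dec (SameSide X Y)
    SameSide? X Y = any? λ x → any? λ y →
      x ∈? X ×-dec ¬? (x ∈? S) ×-dec y ∈? Y ×-dec ¬? (y ∈? S) ×-dec path? S x y

    SameSide-sym : ∀ {X Y} → SameSide X Y → SameSide Y X
    SameSide-sym (x , y , x∈X , x∉S , y∈Y , y∉S , π) = y , x , y∈Y , y∉S , x∈X , x∉S , path-reverse π

    SameSide⇒path : ∀ {X Y p q} → IsClique G X → IsClique G Y → p ∈ X → p ∉ S → q ∈ Y → q ∉ S →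
      SameSide X Y → PathAvoid G S p q
    SameSide⇒path X-clique Y-clique p∈X p∉S q∈Y q∉S (x , y , x∈X , _ , y∈Y , _ , π) =
      path-snoc⁼ (path-cons⁼ (IsClique⇒~⁼ X-clique p∈X x∈X) p∉S π) (IsClique⇒~⁼ Y-clique y∈Y q∈Y) q∉S

    SameSide-shift : ∀ {X Y Z z} → IsClique G X → z ∈ X → z ∈ Y → z ∉ S → SameSide X Z → SameSide Y Z
    SameSide-shift X-clique z∈X z∈Y z∉S (x , w , x∈X , _ , w∈Z , w∉S , π) =
      _ , w , z∈Y , z∉S , w∈Z , w∉S , path-cons⁼ (IsClique⇒~⁼ X-clique z∈X x∈X) z∉S π

    KeptEdge⇒∃∈∩∉S : ∀ {X Y} → KeptEdge G X Y → ∃ λ z → z ∈ X ∩ Y × z ∉ S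
    KeptEdge⇒∃∈∩∉S {X} {Y} kept with X ∩ Y ⊆? S
    ... | yes X∩Y⊆S = ⊥-elim (<⇒≱ (kept-heavier X Y kept) (p⊆q⇒∣p∣≤∣q∣ X∩Y⊆S))
    ... | no X∩Y⊈S = ⊈⇒∃∈∉ X∩Y⊈S

    SameSide-respˡ : ∀ {X Y Z} → SameUnit G X Y → SameSide X Z → SameSide Y Z
    SameSide-respˡ ε X≈Z = X≈Z
    SameSide-respˡ (kept@(((X-clique , _) , _) , _) ◅ rest) X≈Z with KeptEdge⇒∃∈∩∉S kept
    ... | z , z∈X∩Y , z∉S = SameSide-respˡ rest
      (SameSide-shift X-clique (x∈p∩q⇒x∈p z∈X∩Y) (x∈p∩q⇒x∈q z∈X∩Y) z∉S X≈Z)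

    ¬SameSide-respˡ : ∀ {X Y Z} → SameUnit G X Y → ¬ SameSide X Z → ¬ SameSide Y Z
    ¬SameSide-respˡ X~Y X≉Z = X≉Z ∘ SameSide-respˡ (SameUnit-sym X~Y)

    CEdge-leaving-side⇒S⊆∩ : ∀ {X Y Z} → CEdge G X Y → SameSide X Z → ¬ SameSide Y Z → S ⊆ X ∩ Y
    CEdge-leaving-side⇒S⊆∩ {X} {Y} XY@((X-clique , _) , _) X≈Z Y≉Z with X ∩ Y ⊆? S
    ... | yes X∩Y⊆S = p⊆q∧∣q∣≤∣p∣⇒q⊆p X∩Y⊆S (AB-lightest X Y XY)
    ... | no X∩Y⊈S = let z , z∈X∩Y , z∉S = ⊈⇒∃∈∉ X∩Y⊈S in ⊥-elim (Y≉Z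
      (SameSide-shift X-clique (x∈p∩q⇒x∈p z∈X∩Y) (x∈p∩q⇒x∈q z∈X∩Y) z∉S X≈Z))

    SameSide-refl : ∀ {X} → MaxClique G X → SameSide X X
    SameSide-refl {X} (_ , X-max) with X ⊆? S
    ... | no X⊈S = let x , x∈X , x∉S = ⊈⇒∃∈∉ X⊈S in x , x , x∈X , x∉S , x∈X , x∉S , here x∉S
    ... | yes X⊆S = ⊥-elim (A≢B (⊆-antisym A⊆B (proj₂ A-max B (proj₁ B-max) A⊆B)))
      where
      A⊆B : A ⊆ B
      A⊆B a∈A = x∈p∩q⇒x∈q (X⊆S (X-max A (proj₁ A-max) (x∈p∩q⇒x∈p ∘ X⊆S) a∈A))

    ¬SameSide-B-A : ¬ SameSide B A
    ¬SameSide-B-A (b , a , b∈B , b∉S , a∈A , a∉S , π) =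
      let ((_ , _ , ¬path) , _) = S-separates a b a∈A (λ a∈B → a∉S (x∈p∩q⁺ (a∈A , a∈B)))
                                                             b∈B (λ b∈A → b∉S (x∈p∩q⁺ (b∈A , b∈B)))
      in ¬path (path-reverse π)

    ¬SameSide⇒CEdge : ∀ {X Y} → MaxClique G X → MaxClique G Y → S ⊆ X → S ⊆ Y → ¬ SameSide X Y → CEdge G X Y
    ¬SameSide⇒CEdge {X} {Y} X-max Y-max S⊆X S⊆Y X≉Y =
      separating⇒CEdge X-max Y-max (λ { refl → X≉Y (SameSide-refl X-max) })
        λ u v u∈X u∉Y v∈Y v∉X π → X≉Y
          (u , v , u∈X , u∉Y ∘ S⊆Y , v∈Y , v∉X ∘ S⊆X , path-weaken (λ s∈S → x∈p∩q⁺ (S⊆X s∈S , S⊆Y s∈S)) π)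

    private
      module Merge {X Y} (X-max : MaxClique G X) (Y-max : MaxClique G Y) (S⊆X : S ⊆ X) (S⊆Y : S ⊆ Y)
        (recurse : ∀ {X' Y'} → (X' ∩ Y') ⊃ (X ∩ Y) → MaxClique G X' → MaxClique G Y' →
                   S ⊆ X' → S ⊆ Y' → SameSide X' Y' → SameUnit G X' Y') where

        I : Subset n
        I = X ∩ Y

        S⊆I : S ⊆ I
        S⊆I s∈S = x∈p∩q⁺ (S⊆X s∈S , S⊆Y s∈S)

        X-clique : IsClique G X
        X-clique = proj₁ X-max

        Y-clique : IsClique G Y
        Y-clique = proj₁ Y-max

        joined-at : ∀ {X' Y'} z → MaxClique G X' → MaxClique G Y' → I ⊆ X' → I ⊆ Y' →
          z ∈ X' → z ∈ Y' → z ∉ I → SameUnit G X' Y'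
        joined-at z X'-max Y'-max I⊆X' I⊆Y' z∈X' z∈Y' z∉I =
          recurse ((λ x∈I → x∈p∩q⁺ (I⊆X' x∈I , I⊆Y' x∈I)) , z , x∈p∩q⁺ (z∈X' , z∈Y') , z∉I)
            X'-max Y'-max (I⊆X' ∘ S⊆I) (I⊆Y' ∘ S⊆I) (z , z , z∈X' , z∉S , z∈Y' , z∉S , here z∉S)
          where
          z∉S : z ∉ S
          z∉S = z∉I ∘ S⊆I

        -- each edge g l ~ g (l + 1) and I extend to a maximal clique; consecutive ones share I ∪ ⁅ g l ⁆
        joined-along : ∀ m g → CommonNeighbourPath I m g → ∀ {X' Y'} → MaxClique G X' → MaxClique G Y' →
          I ⊆ X' → I ⊆ Y' → g 0 ∈ X' → g m ∈ Y' → SameUnit G X' Y'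
        joined-along zero g P X'-max Y'-max I⊆X' I⊆Y' g₀∈X' g₀∈Y' =
          joined-at (g 0) X'-max Y'-max I⊆X' I⊆Y' g₀∈X' g₀∈Y' (CommonNeighbourPath.avoids P 0 z≤n)
        joined-along (suc m) g P X'-max Y'-max I⊆X' I⊆Y' g₀∈X' gₘ₊₁∈Y'
          with IsClique⇒⊆MaxClique {(I ∪ ⁅ g 0 ⁆) ∪ ⁅ g 1 ⁆} edge-clique
          where
          open CommonNeighbourPath P
          edge-clique : IsClique G ((I ∪ ⁅ g 0 ⁆) ∪ ⁅ g 1 ⁆)
          edge-clique = IsClique-∪⁅⁆
            (IsClique-∪⁅⁆ (λ a b a∈I b∈I → X-clique a b (x∈p∩q⇒x∈p a∈I) (x∈p∩q⇒x∈p b∈I))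
                          (λ c c∈I _ → dominated 0 z≤n c c∈I))
            (λ c c∈ _ → [ (λ c∈I → dominated 1 (s≤s z≤n) c c∈I) , (λ { refl → adjacent 0 (s≤s z≤n) }) ]′
                          (x∈p∪⁅y⁆⁻ c∈))
        ... | M , M-max , ⊆M =
          joined-at (g 0) X'-max M-max I⊆X' I⊆M g₀∈X' (⊆M (p⊆p∪q _ (x∈p∪q⁺ (inj₂ (x∈⁅x⁆ (g 0))))))
                    (CommonNeighbourPath.avoids P 0 z≤n)
          ◅◅ joined-along m (g ∘ suc) (CommonNeighbourPath-tail P) M-max Y'-max I⊆M I⊆Y'
                          (⊆M (x∈p∪q⁺ (inj₂ (x∈⁅x⁆ (g 1))))) gₘ₊₁∈Y'
          where
          I⊆M : I ⊆ M
          I⊆M x∈I = ⊆M (p⊆p∪q _ (p⊆p∪q _ x∈I))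

        -- p ∈ X ∖ Y and q ∈ Y ∖ X: either I separates them, and XY is a kept edge,
        -- or a path in the common neighbourhood of I joins them
        merge : SameSide X Y → X ≢ Y → SameUnit G X Y
        merge X≈Y X≢Y with MaxClique-≢⇒∃∈∉ X-max Y-max X≢Y | MaxClique-≢⇒∃∈∉ Y-max X-max (X≢Y ∘ sym)
        ... | p , p∈X , p∉Y | q , q∈Y , q∉X with path? I p q
        ...   | no ¬path = (XY , XY-heavy) ◅ ε
          where
          p∉I : p ∉ I
          p∉I = p∉Y ∘ x∈p∩q⇒x∈q
          q∉I : q ∉ I
          q∉I = q∉X ∘ x∈p∩q⇒x∈p
          XY : CEdge G X Y
          XY = separating⇒CEdge X-max Y-max X≢Y λ u v u∈X _ v∈Y _ π → ¬path
            (path-snoc⁼ (path-cons⁼ (IsClique⇒~⁼ X-clique p∈X u∈X) p∉I π)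
                        (IsClique⇒~⁼ Y-clique v∈Y q∈Y) q∉I)
          XY-heavy : ¬ MinWeightEdge G X Y
          XY-heavy (_ , lightest) = ¬path (path-weaken (p⊆q∧∣q∣≤∣p∣⇒q⊆p S⊆I (lightest A B AB))
            (SameSide⇒path X-clique Y-clique p∈X (p∉Y ∘ S⊆Y) q∈Y (q∉X ∘ S⊆X) X≈Y))
        ...   | yes π with chordal⇒common-neighbour-path chordal π
                             (λ x x∈I → X-clique x p (x∈p∩q⇒x∈p x∈I) p∈X λ { refl → p∉Y (x∈p∩q⇒x∈q x∈I) })
                             (λ x x∈I → Y-clique x q (x∈p∩q⇒x∈q x∈I) q∈Y λ { refl → q∉X (x∈p∩q⇒x∈p x∈I) })
        ...     | m , g , refl , refl , P =
          joined-along m g P X-max Y-max x∈p∩q⇒x∈p x∈p∩q⇒x∈q p∈X q∈Y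

    SameSide⇒SameUnit : ∀ {X Y} → MaxClique G X → MaxClique G Y → S ⊆ X → S ⊆ Y →
      SameSide X Y → SameUnit G X Y
    SameSide⇒SameUnit {X} {Y} = go (⊃-wellFounded (X ∩ Y))
      where
      go : ∀ {X Y} → Acc _⊃_ (X ∩ Y) → MaxClique G X → MaxClique G Y → S ⊆ X → S ⊆ Y →
        SameSide X Y → SameUnit G X Y
      go {X} {Y} (acc larger) X-max Y-max S⊆X S⊆Y X≈Y with X ≟ˢ Y
      ... | yes refl = ε
      ... | no X≢Y = Merge.merge X-max Y-max S⊆X S⊆Y (λ sup → go (larger sup)) X≈Y X≢Y

  module PreviousLayer (chordal : Chordal G) {Kstar K L L' : Subset n} {i : ℕ}
    (K-shortest : ∀ j → j < suc i → ¬ LayerWalk G Kstar K j)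
    (L-walk : LayerWalk G Kstar L i) (L-shortest : ∀ j → j < i → ¬ LayerWalk G Kstar L j)
    (L'-walk : LayerWalk G Kstar L' i)
    {A B A' B' : Subset n} (K≁L : ¬ SameUnit G K L) (K~A : SameUnit G K A) (L~B : SameUnit G L B)
    (AB : CEdge G A B) (K~A' : SameUnit G K A') (L'~B' : SameUnit G L' B') (A'B' : CEdge G A' B')
    where

    A≁B : ¬ SameUnit G A B
    A≁B A~B = K≁L (K~A ◅◅ A~B ◅◅ SameUnit-sym L~B)

    open Separation chordal AB (¬SameUnit⇒lightest AB A≁B) (¬SameUnit⇒kept-heavier AB A≁B)

    S⊆A : S ⊆ A
    S⊆A = x∈p∩q⇒x∈p

    S⊆B : S ⊆ B
    S⊆B = x∈p∩q⇒x∈q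

    A-unit-not-before : ∀ {X j} → j ≤ i → LayerWalk G Kstar X j → ¬ SameUnit G X A
    A-unit-not-before j≤i X-walk X~A =
      K-shortest _ (s≤s j≤i) (LayerWalk-respʳ X-walk (X~A ◅◅ SameUnit-sym K~A))

    B-unit-not-before : ∀ {X j} → j < i → LayerWalk G Kstar X j → ¬ SameUnit G X B
    B-unit-not-before j<i X-walk X~B = L-shortest _ j<i (LayerWalk-respʳ X-walk (X~B ◅◅ SameUnit-sym L~B))

    K≈A : SameSide K A
    K≈A = SameSide-respˡ (SameUnit-sym K~A) (SameSide-refl A-max)

    L≉A : ¬ SameSide L A
    L≉A = ¬SameSide-respˡ (SameUnit-sym L~B) ¬SameSide-B-A

    root≉A : ¬ SameSide Kstar A
    root≉A root≈A = A-unit-not-before (<⇒≤ j<l) walk-X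
      (SameSide⇒SameUnit (CEdge-maxˡ edge) A-max (x∈p∩q⇒x∈p ∘ S⊆X∩Y) S⊆A P-X)
      where
      open Crossing (LayerWalk⇒Crossing (λ X → SameSide? X A) SameSide-respˡ L-walk root≈A L≉A)
      S⊆X∩Y : S ⊆ X ∩ Y
      S⊆X∩Y = CEdge-leaving-side⇒S⊆∩ edge P-X ¬P-Y

    L'≉A : ¬ SameSide L' A
    L'≉A L'≈A = A-unit-not-before j<l walk-Y
      (SameSide⇒SameUnit (CEdge-maxʳ edge) A-max (x∈p∩q⇒x∈p ∘ S⊆Y∩X) S⊆A Y≈A)
      where
      open Crossing (LayerWalk⇒Crossing (λ X → ¬? (SameSide? X A)) ¬SameSide-respˡ L'-walk root≉A
                                        (λ L'≉A → L'≉A L'≈A))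
      Y≈A : SameSide Y A
      Y≈A = decidable-stable (SameSide? Y A) ¬P-Y
      S⊆Y∩X : S ⊆ Y ∩ X
      S⊆Y∩X = CEdge-leaving-side⇒S⊆∩ (CEdge-sym edge) Y≈A P-X

    S⊆B' : S ⊆ B'
    S⊆B' = x∈p∩q⇒x∈q ∘ CEdge-leaving-side⇒S⊆∩ A'B' (SameSide-respˡ K~A' K≈A) (¬SameSide-respˡ L'~B' L'≉A)

    -- such a clique X lies in the unit of A or is adjacent to the unit of K, and K is in layer i + 1
    ⊇S-not-before : ∀ {X j} → j < i → LayerWalk G Kstar X j → MaxClique G X → S ⊆ X → ⊥
    ⊇S-not-before {X} j<i X-walk X-max S⊆X with SameSide? X A
    ... | yes X≈A = A-unit-not-before (<⇒≤ j<i) X-walk (SameSide⇒SameUnit X-max A-max S⊆X S⊆A X≈A)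
    ... | no X≉A = K-shortest _ (s≤s j<i) (LayerWalk-snoc X-walk
      ((λ X~K → X≉A (SameSide-respˡ (SameUnit-sym X~K) K≈A)) , X , A , ε , K~A ,
       ¬SameSide⇒CEdge X-max A-max S⊆X S⊆A X≉A))

    B≈B' : SameSide B B'
    B≈B' = decidable-stable (SameSide? B B') λ B≉B' → case-root B≉B' (SameSide? Kstar B)
      where
      case-root : ¬ SameSide B B' → Dec (SameSide Kstar B) → ⊥
      case-root B≉B' (yes root≈B) = B-unit-not-before j<l walk-X
        (SameSide⇒SameUnit (CEdge-maxˡ edge) B-max
                           (x∈p∩q⇒x∈p ∘ CEdge-leaving-side⇒S⊆∩ edge P-X ¬P-Y) S⊆B P-X)
        where
        open Crossing (LayerWalk⇒Crossing (λ X → SameSide? X B) SameSide-respˡ L'-walk root≈B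
                        (¬SameSide-respˡ (SameUnit-sym L'~B') (B≉B' ∘ SameSide-sym)))
      case-root _ (no root≉B) = ⊇S-not-before j<l walk-X (CEdge-maxˡ edge)
        (x∈p∩q⇒x∈q ∘ CEdge-leaving-side⇒S⊆∩ (CEdge-sym edge) (decidable-stable (SameSide? _ B) ¬P-Y) P-X)
        where
        open Crossing (LayerWalk⇒Crossing (λ X → ¬? (SameSide? X B)) ¬SameSide-respˡ L-walk root≉B
                        (λ L≉B → L≉B (SameSide-respˡ (SameUnit-sym L~B) (SameSide-refl B-max))))

    L~L' : SameUnit G L L'
    L~L' = L~B ◅◅ SameSide⇒SameUnit B-max (CEdge-maxʳ A'B') S⊆B S⊆B' B≈B' ◅◅ SameUnit-sym L'~B'

  InLayer-suc⇒unique-previous : Chordal G → ∀ {Kstar i K L L'} → InLayer G Kstar (suc i) K →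
    InLayer G Kstar i L → LayerWalk G Kstar L' i → LayerAdj G K L → LayerAdj G K L' → SameUnit G L L'
  InLayer-suc⇒unique-previous chordal (_ , K-shortest) (L-walk , L-shortest) L'-walk
    (K≁L , _ , _ , K~A , L~B , AB) (_ , _ , _ , K~A' , L'~B' , A'B') =
    PreviousLayer.L~L' chordal K-shortest L-walk L-shortest L'-walk K≁L K~A L~B AB K~A' L'~B' A'B'

mainTheorem6 : ∀ (n : ℕ) (G : Graph n) → Connected G → Chordal G →
    ∀ (Kstar : Subset n) → MaxClique G Kstar →
    ∀ (i : ℕ) (K : Subset n) → MaxClique G K → InLayer G Kstar (suc i) K →
      (∃[ K' ] (MaxClique G K' × InLayer G Kstar i K' × LayerAdj G K K'))
      × (∀ L L' → MaxClique G L → MaxClique G L' →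
           InLayer G Kstar i L → InLayer G Kstar i L' →
           LayerAdj G K L → LayerAdj G K L' → SameUnit G L L')
mainTheorem6 _ G _ chordal _ _ _ _ _ K-in-layer =
  InLayer-suc⇒adjacent-to-previous G K-in-layer ,
  λ _ _ _ _ L-in-layer (L'-walk , _) → InLayer-suc⇒unique-previous G chordal K-in-layer L-in-layer L'-walk
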